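{- Let $f\colon \mathbb{N}\to\mathbb{R}^{\geq 0}$ be the function defined in the context. Then $|f(a+n)-f(a)|\geq \frac{1}{n}$ for all $a\geq 0$ and $n\geq 1$.
   Context: $\mathbb{N}=\{0,1,2,\dots\}$. Let $F_n$ denote the Fibonacci numbers, $F_0=0$, $F_1=1$, $F_n=F_{n-1}+F_{n-2}$ for $n>1$, and let $u_i=F_{2i}$ for $i\geq 1$. Every $N\in\mathbb{N}$ has a unique representation $N=\sum_{i=1}^\infty d_iu_i$ with digits $d_i\in\{0,1,2\}$, only finitely many nonzero, such that whenever $i<j$ and $d_i=d_j=2$ there exists $l$ with $i<l<j$ and $d_l=0$. For $a\in\mathbb{N}$ write $d^a_i$ for the digits of this representation of $a$, and define $f(a)=\sum_{i=1}^\infty \frac{d^a_i}{u_i}$. -}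

module Defs where

open import Data.Nat using (ℕ; zero; suc; _+_; _*_; _≤_; _<_; NonZero; s≤s; z≤n; >-nonZero)
open import Data.Nat.Properties using (≤-trans; m≤m+n; +-suc)
open import Data.Integer using (+_)
open import Data.Rational using (ℚ; _/_; 0ℚ) renaming (_+_ to _+ℚ_)
open import Data.List using (List; []; _∷_)
open import Data.List.Relation.Unary.All using (All)
open import Data.Product using (Σ; _×_; ∃)
open import Relation.Binary.PropositionalEquality using (_≡_)

F : ℕ → ℕ
F zero = 0
F (suc zero) = 1
F (suc (suc n)) = F (suc n) + F n

-- u_i = F_{2i}  (used for i ≥ 1)
u : ℕ → ℕ
u i = F (i + i)

F-suc-pos : ∀ n → 1 ≤ F (suc n)
F-suc-pos zero = s≤s z≤n
F-suc-pos (suc n) = ≤-trans (F-suc-pos n) (m≤m+n (F (suc n)) (F n))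

u-pos : ∀ k → 1 ≤ u (suc k)
u-pos k rewrite +-suc k k = F-suc-pos (suc (k + k))

u-nonZero : ∀ k → NonZero (u (suc k))
u-nonZero k = >-nonZero (u-pos k)

-- A digit string is a list [d_1, d_2, ...]; digits beyond its length are 0.
-- digit ds i = d_i  (1-based; digit ds 0 = 0 is a dummy value)
digit : List ℕ → ℕ → ℕ
digit [] i = 0
digit (d ∷ ds) zero = 0
digit (d ∷ ds) (suc zero) = d
digit (d ∷ ds) (suc (suc i)) = digit ds (suc i)

valueFrom : ℕ → List ℕ → ℕ
valueFrom k [] = 0
valueFrom k (d ∷ ds) = d * u (suc k) + valueFrom (suc k) ds

value : List ℕ → ℕ
value ds = valueFrom 0 ds

Admissible : List ℕ → Set
Admissible ds =
  All (λ d → d ≤ 2) ds ×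
  (∀ i j → 1 ≤ i → i < j → digit ds i ≡ 2 → digit ds j ≡ 2 →
     ∃ λ l → i < l × l < j × digit ds l ≡ 0)

IsRep : ℕ → List ℕ → Set
IsRep N ds = Admissible ds × value ds ≡ N

fFrom : ℕ → List ℕ → ℚ
fFrom k [] = 0ℚ
fFrom k (d ∷ ds) = (_/_ (+ d) (u (suc k)) {{u-nonZero k}}) +ℚ fFrom (suc k) ds

fDigits : List ℕ → ℚ
fDigits ds = fFrom 0 ds

-- Write a_i(w) for the value of the digit string w shifted down i places. For admissible w of length at
-- most K, a_{i+1}(w) = ⌊a_i(w) u_K / u_{K+1}⌋: the remainder is the value of w read backwards, which is
-- again admissible and hence below u_{K+1}. This floor map is monotone, superadditive, and subadditive up
-- to 1. Each digit is the second difference a_{i-1} − 3a_i + a_{i+1}, so summation by parts writes f as a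
-- linear form in the a_i whose later coefficients 1/u_i − 3/u_{i+1} + 1/u_{i+2} are nonnegative by Cassini's
-- identity; hence f(x) + f(m) ≤ f(y) whenever a_0 and a_1 are additive on x, m, y.
-- Let x, y represent a and a + n, and m be the greedy expansion of n, so that f(m) ≥ 1/n. If a_1 is additive,
-- f(a + n) ≥ f(a) + 1/n. Otherwise a carry was lost at level 1. Let x⁺ be x with an extra digit 1 at a high
-- position M and m′ the greedy expansion of u_M − n, so y + m′ = x⁺. As ⌊u_M² / u_{M+1}⌋ = u_{M−1}, the new
-- digit makes up for the lost carry, a_1 is additive, and f(a + n) + f(m′) ≤ f(a) + 1/u_M, while
-- f(m′) ≥ 1/n + 1/u_M.

module Submission where

open import Defs
open import Data.Nat using (ℕ; zero; suc; pred; _+_; _*_; _∸_; _≤_; _<_; z≤n; s≤s; NonZero; >-nonZero; >-nonZero⁻¹)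
open import Data.Nat.Properties
open import Data.Nat.DivMod using (_/_; _%_; m≡m%n+[m/n]*n; m%n<n; m*n/n≡m; m/n*n≤m; /-monoˡ-≤; m<n*o⇒m/o<n)
open import Data.Nat.Tactic.RingSolver using (solve-∀)
open import Data.List using (List; []; _∷_; _++_; length; drop; replicate)
open import Data.List.Properties using (length-++; length-replicate; length-drop; drop-drop)
open import Data.List.Relation.Unary.All using (_∷_)
open import Data.Product using (∃; _×_; _,_; proj₂)
open import Data.Sum using (inj₁; inj₂)
open import Data.Empty using (⊥-elim)
open import Data.Integer as ℤ using (+_)
import Data.Integer.Properties as ℤ
open import Data.Rational as ℚ using (ℚ; 0ℚ; toℚᵘ)
import Data.Rational.Properties as ℚ
import Data.Rational.Unnormalised as ℚᵘ
import Data.Rational.Unnormalised.Properties as ℚᵘ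
open import Relation.Nullary.Decidable using (dec⇒maybe)
import Tactic.RingSolver as Ring
open import Tactic.RingSolver.Core.AlmostCommutativeRing using (AlmostCommutativeRing; fromCommutativeRing)
open import Relation.Binary.PropositionalEquality

-- Fibonacci identities

v : ℕ → ℕ
v k = F (suc (k + k))

u-suc : ∀ k → u (suc k) ≡ v k + u k
u-suc k = cong (λ n → F (suc n)) (+-suc k k)

v-suc : ∀ k → v (suc k) ≡ u (suc k) + v k
v-suc k = trans (cong (λ n → F (suc (suc n))) (+-suc k k)) (cong (_+ v k) (sym (u-suc k)))

u-suc-suc : ∀ k → u (suc (suc k)) ≡ 2 * u (suc k) + v k
u-suc-suc k rewrite u-suc (suc k) | v-suc k = identity (u (suc k)) (v k)
  where
  identity : ∀ a b → a + b + a ≡ 2 * a + b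
  identity = solve-∀

u-three-term : ∀ k → u (suc (suc k)) + u k ≡ 3 * u (suc k)
u-three-term k rewrite u-suc-suc k | u-suc k = identity (v k) (u k)
  where
  identity : ∀ b a → 2 * (b + a) + b + a ≡ 3 * (b + a)
  identity = solve-∀

u-addition : ∀ p q → u (suc p) * u (p + q) ≡ u p * u (suc (p + q)) + u q
u-addition zero q = +-identityʳ (u q)
u-addition (suc p) q = +-cancelʳ-≡ (c * B) (X * B) (A * Y + u q) (begin
  X * B + c * B        ≡⟨ sym (*-distribʳ-+ B X c) ⟩
  (X + c) * B          ≡⟨ cong (_* B) (u-three-term p) ⟩
  3 * A * B            ≡⟨ identity₁ A B ⟩
  A * (3 * B)          ≡⟨ cong (A *_) (sym (u-three-term (p + q))) ⟩
  A * (Y + u (p + q))  ≡⟨ *-distribˡ-+ A Y (u (p + q)) ⟩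
  A * Y + A * u (p + q) ≡⟨ cong (λ t → A * Y + t) (u-addition p q) ⟩
  A * Y + (c * B + u q) ≡⟨ identity₂ (A * Y) (c * B) (u q) ⟩
  A * Y + u q + c * B  ∎)
  where
  open ≡-Reasoning
  c = u p
  A = u (suc p)
  X = u (suc (suc p))
  B = u (suc (p + q))
  Y = u (suc (suc (p + q)))
  identity₁ : ∀ a b → 3 * a * b ≡ a * (3 * b)
  identity₁ = solve-∀
  identity₂ : ∀ a b c → a + (b + c) ≡ a + c + b
  identity₂ = solve-∀

u-cassini : ∀ k → u (suc k) * u (suc k) ≡ u k * u (suc (suc k)) + 1
u-cassini k = subst (λ n → u (suc k) * u n ≡ u k * u (suc n) + 1) (+-comm k 1) (u-addition k 1)

cassini : ∀ k → v k * v k ≡ u k * u k + u k * v k + 1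
cassini zero = refl
cassini (suc k) rewrite v-suc k | u-suc k =
  +-cancelʳ-≡ (a * a + a * b + 1) _ _ (trans (identity a b) (cong (_+_ rhs) (cassini k)))
  where
  a = u k
  b = v k
  rhs = (b + a) * (b + a) + (b + a) * (b + a + b) + 1
  identity : ∀ a b → (b + a + b) * (b + a + b) + (a * a + a * b + 1)
                   ≡ (b + a) * (b + a) + (b + a) * (b + a + b) + 1 + b * b
  identity = solve-∀

modulo-cassini : ∀ k c m n → m + c * (u k * u k + u k * v k + 1) ≡ n + c * (v k * v k) → m ≡ n
modulo-cassini k c m n eq = +-cancelʳ-≡ _ m n (trans eq (cong (λ t → n + c * t) (cassini k)))

u-suc-suc≡1*u+v : ∀ k → u (suc (suc k)) ≡ 1 * u (suc k) + v (suc k)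
u-suc-suc≡1*u+v k = trans (u-suc (suc k)) (trans (+-comm (v (suc k)) (u (suc k))) (cong (_+ v (suc k)) (sym (*-identityˡ (u (suc k))))))

v-suc≡1*u+v : ∀ k → v (suc k) ≡ 1 * u (suc k) + v k
v-suc≡1*u+v k = trans (v-suc k) (cong (_+ v k) (sym (*-identityˡ (u (suc k)))))

v-pos : ∀ k → 1 ≤ v k
v-pos k = F-suc-pos (k + k)

v-nonZero : ∀ k → NonZero (v k)
v-nonZero k = >-nonZero (v-pos k)

n≤u : ∀ n → n ≤ u n
n≤u zero = z≤n
n≤u (suc n) rewrite u-suc n = +-mono-≤ (v-pos n) (n≤u n)

v≤u-suc : ∀ k → v k ≤ u (suc k)
v≤u-suc k rewrite u-suc k = m≤m+n (v k) (u k)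

u≤v : ∀ k → u (suc k) ≤ v (suc k)
u≤v k rewrite v-suc k = m≤m+n (u (suc k)) (v k)

u-suc-mono : ∀ k → u (suc k) ≤ u (suc (suc k))
u-suc-mono k rewrite u-suc (suc k) = m≤n+m (u (suc k)) (v (suc k))

u≤3u : ∀ k → u (suc (suc k)) ≤ 3 * u (suc k)
u≤3u k = subst (u (suc (suc k)) ≤_) (u-three-term k) (m≤m+n _ (u k))

v≤2u : ∀ k → v (suc k) ≤ 2 * u (suc k)
v≤2u k rewrite v-suc k = subst (u (suc k) + v k ≤_) (cong (_+_ (u (suc k))) (sym (+-identityʳ (u (suc k)))))
  (+-monoʳ-≤ (u (suc k)) (v≤u-suc k))

valueFrom-++ : ∀ k xs ys → valueFrom k (xs ++ ys) ≡ valueFrom k xs + valueFrom (k + length xs) ys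
valueFrom-++ k [] ys = cong (λ j → valueFrom j ys) (sym (+-identityʳ k))
valueFrom-++ k (x ∷ xs) ys rewrite valueFrom-++ (suc k) xs ys | +-suc k (length xs) =
  sym (+-assoc (x * u (suc k)) (valueFrom (suc k) xs) _)

valueFrom-zeros : ∀ k z ys → valueFrom k (replicate z 0 ++ ys) ≡ valueFrom (k + z) ys
valueFrom-zeros k zero ys = cong (λ j → valueFrom j ys) (sym (+-identityʳ k))
valueFrom-zeros k (suc z) ys rewrite +-suc k z = valueFrom-zeros (suc k) z ys

valueFrom-three-term : ∀ k ds → valueFrom (suc (suc k)) ds + valueFrom k ds ≡ 3 * valueFrom (suc k) ds
valueFrom-three-term k [] = refl
valueFrom-three-term k (d ∷ ds) = begin
  d * X + V₂ + (d * Z + V₀)  ≡⟨ identity d X V₂ Z V₀ ⟩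
  d * (X + Z) + (V₂ + V₀)    ≡⟨ cong₂ (λ a b → d * a + b) (u-three-term (suc k)) (valueFrom-three-term (suc k) ds) ⟩
  d * (3 * Y) + 3 * V₁       ≡⟨ identity′ d Y V₁ ⟩
  3 * (d * Y + V₁)           ∎
  where
  open ≡-Reasoning
  X = u (suc (suc (suc k)))
  Y = u (suc (suc k))
  Z = u (suc k)
  V₂ = valueFrom (suc (suc (suc k))) ds
  V₁ = valueFrom (suc (suc k)) ds
  V₀ = valueFrom (suc k) ds
  identity : ∀ d X V₂ Z V₀ → d * X + V₂ + (d * Z + V₀) ≡ d * (X + Z) + (V₂ + V₀)
  identity = solve-∀
  identity′ : ∀ d Y V₁ → d * (3 * Y) + 3 * V₁ ≡ 3 * (d * Y + V₁)
  identity′ = solve-∀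

shifted : ℕ → List ℕ → ℕ
shifted i w = value (drop i w)

shifted-tail : ∀ i w → shifted i (drop 1 w) ≡ shifted (suc i) w
shifted-tail i w = cong value (drop-drop 1 i w)

first-digit≡second-difference : ∀ w → digit w 1 + 3 * shifted 1 w ≡ shifted 0 w + shifted 2 w
first-digit≡second-difference [] = refl
first-digit≡second-difference (d ∷ []) = identity d
  where
  identity : ∀ d → d + 3 * 0 ≡ d * 1 + 0 + 0
  identity = solve-∀
first-digit≡second-difference (d ∷ e ∷ es) = begin
  d + 3 * (e * 1 + V₁)       ≡⟨ identity d e V₁ ⟩
  d * 1 + e * 3 + 3 * V₁     ≡⟨ cong (λ t → d * 1 + e * 3 + t) (sym (valueFrom-three-term 0 es)) ⟩
  d * 1 + e * 3 + (V₂ + V₀)  ≡⟨ identity′ (d * 1) (e * 3) V₂ V₀ ⟩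
  d * 1 + (e * 3 + V₂) + V₀  ∎
  where
  open ≡-Reasoning
  V₀ = valueFrom 0 es
  V₁ = valueFrom 1 es
  V₂ = valueFrom 2 es
  identity : ∀ d e v → d + 3 * (e * 1 + v) ≡ d * 1 + e * 3 + 3 * v
  identity = solve-∀
  identity′ : ∀ a b c d → a + b + (c + d) ≡ a + (b + c) + d
  identity′ = solve-∀

reversedValue : ℕ → List ℕ → ℕ
reversedValue zero    ds       = 0
reversedValue (suc j) []       = 0
reversedValue (suc j) (d ∷ ds) = d * u j + reversedValue j ds

valueFrom-shift : ∀ ds k j → length ds ≤ j →
  valueFrom (suc k) ds * u (k + j) ≡ valueFrom k ds * u (suc (k + j)) + reversedValue j ds
valueFrom-shift [] k zero _ = refl
valueFrom-shift [] k (suc j) _ = refl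
valueFrom-shift (d ∷ ds) k (suc j) (s≤s len) rewrite +-suc k j = begin
  (d * u (2 + k) + valueFrom (2 + k) ds) * u (suc (k + j))
    ≡⟨ identity d (u (2 + k)) (valueFrom (2 + k) ds) (u (suc (k + j))) ⟩
  d * (u (2 + k) * u (suc (k + j))) + valueFrom (2 + k) ds * u (suc (k + j))
    ≡⟨ cong₂ (λ a b → d * a + b) (u-addition (suc k) j) (valueFrom-shift ds (suc k) j len) ⟩
  d * (u (suc k) * u (2 + (k + j)) + u j) + (valueFrom (suc k) ds * u (2 + (k + j)) + reversedValue j ds)
    ≡⟨ identity′ d (u (suc k)) (u (2 + (k + j))) (u j) (valueFrom (suc k) ds) (reversedValue j ds) ⟩
  (d * u (suc k) + valueFrom (suc k) ds) * u (2 + (k + j)) + (d * u j + reversedValue j ds) ∎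
  where
  open ≡-Reasoning
  identity : ∀ d a b c → (d * a + b) * c ≡ d * (a * c) + b * c
  identity = solve-∀
  identity′ : ∀ d a b c e f → d * (a * b + c) + (e * b + f) ≡ (d * a + e) * b + (d * c + f)
  identity′ = solve-∀

value-tail : ∀ w K → length w ≤ suc K →
  value w * u K ≡ shifted 1 w * u (suc K) + reversedValue (suc K) w
value-tail [] K _ = refl
value-tail (d ∷ ds) K (s≤s len) = begin
  (d * 1 + valueFrom 1 ds) * u K                               ≡⟨ identity d (valueFrom 1 ds) (u K) ⟩
  d * u K + valueFrom 1 ds * u K                               ≡⟨ cong (λ t → d * u K + t) (valueFrom-shift ds 0 K len) ⟩
  d * u K + (value ds * u (suc K) + reversedValue K ds)        ≡⟨ identity′ (d * u K) (value ds * u (suc K)) _ ⟩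
  value ds * u (suc K) + (d * u K + reversedValue K ds)        ∎
  where
  open ≡-Reasoning
  identity : ∀ d a b → (d * 1 + a) * b ≡ d * b + a * b
  identity = solve-∀
  identity′ : ∀ a b c → a + (b + c) ≡ b + (a + c)
  identity′ = solve-∀

-- Admissible strings as runs of an automaton

data Mode : Set where
  free pending : Mode

-- In mode pending a 2 has been read and no 0 since, so a further 2 is forbidden.
data Run : Mode → List ℕ → Mode → Set where
  []    : ∀ {s} → Run s [] s
  read0 : ∀ {s ds t} → Run free ds t → Run s (0 ∷ ds) t
  read1 : ∀ {s ds t} → Run s ds t → Run s (1 ∷ ds) t
  read2 : ∀ {ds t} → Run pending ds t → Run free (2 ∷ ds) t

Accepted : List ℕ → Set
Accepted ds = ∃ (Run free ds)

Run-++ : ∀ {s xs t ys t′} → Run s xs t → Run t ys t′ → Run s (xs ++ ys) t′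
Run-++ []        ρ = ρ
Run-++ (read0 σ) ρ = read0 (Run-++ σ ρ)
Run-++ (read1 σ) ρ = read1 (Run-++ σ ρ)
Run-++ (read2 σ) ρ = read2 (Run-++ σ ρ)

pending⇒accepted : ∀ {ds t} → Run pending ds t → Accepted ds
pending⇒accepted []        = free , []
pending⇒accepted (read0 σ) = _ , read0 σ
pending⇒accepted (read1 σ) with pending⇒accepted σ
... | t , σ′ = t , read1 σ′

accepted-tail : ∀ {d ds} → Accepted (d ∷ ds) → Accepted ds
accepted-tail (_ , read0 σ) = _ , σ
accepted-tail (_ , read1 σ) = _ , σ
accepted-tail (_ , read2 σ) = pending⇒accepted σ

accepted-drop : ∀ i {ds} → Accepted ds → Accepted (drop i ds)
accepted-drop zero    α = α
accepted-drop (suc i) {[]} α = α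
accepted-drop (suc i) {d ∷ ds} α = accepted-drop i (accepted-tail α)

ZeroBeforeEveryTwo : List ℕ → Set
ZeroBeforeEveryTwo ds = ∀ j → 1 ≤ j → digit ds j ≡ 2 → ∃ λ l → 1 ≤ l × l < j × digit ds l ≡ 0

Separated : List ℕ → Set
Separated ds = ∀ i j → 1 ≤ i → i < j → digit ds i ≡ 2 → digit ds j ≡ 2 → ∃ λ l → i < l × l < j × digit ds l ≡ 0

separated-tail : ∀ {d ds} → Separated (d ∷ ds) → Separated ds
separated-tail separated (suc i) (suc j) _ (s≤s i<j) eᵢ eⱼ
  with separated (suc (suc i)) (suc (suc j)) (s≤s z≤n) (s≤s (s≤s i<j)) eᵢ eⱼ
... | suc (suc l) , s≤s (s≤s i<l) , s≤s l<j , e = suc l , s≤s i<l , l<j , e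

admissible-tail : ∀ {d ds} → Admissible (d ∷ ds) → Admissible ds
admissible-tail (_ ∷ digits , separated) = digits , separated-tail separated

zeroBeforeEveryTwo-tail : ∀ {ds} → ZeroBeforeEveryTwo (1 ∷ ds) → ZeroBeforeEveryTwo ds
zeroBeforeEveryTwo-tail z (suc j) _ e with z (suc (suc j)) (s≤s z≤n) e
... | suc (suc l) , _ , s≤s l<j , e′ = suc l , s≤s z≤n , l<j , e′

after-two : ∀ {ds} → Admissible (2 ∷ ds) → ZeroBeforeEveryTwo ds
after-two (_ , separated) (suc j) _ e with separated 1 (suc (suc j)) (s≤s z≤n) (s≤s (s≤s z≤n)) refl e
... | suc (suc l) , _ , s≤s l<j , e′ = suc l , s≤s z≤n , l<j , e′

admissible⇒run-free    : ∀ {ds} → Admissible ds → ∃ (Run free ds)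
admissible⇒run-pending : ∀ {ds} → Admissible ds → ZeroBeforeEveryTwo ds → ∃ (Run pending ds)

admissible⇒run-free {[]} _ = free , []
admissible⇒run-free {0 ∷ ds} α with admissible⇒run-free (admissible-tail α)
... | t , σ = t , read0 σ
admissible⇒run-free {1 ∷ ds} α with admissible⇒run-free (admissible-tail α)
... | t , σ = t , read1 σ
admissible⇒run-free {2 ∷ ds} α with admissible⇒run-pending (admissible-tail α) (after-two α)
... | t , σ = t , read2 σ
admissible⇒run-free {suc (suc (suc _)) ∷ ds} (s≤s (s≤s ()) ∷ _ , _)

admissible⇒run-pending {[]} _ _ = pending , []
admissible⇒run-pending {0 ∷ ds} α _ with admissible⇒run-free (admissible-tail α)
... | t , σ = t , read0 σ
admissible⇒run-pending {1 ∷ ds} α z with admissible⇒run-pending (admissible-tail α) (zeroBeforeEveryTwo-tail z)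
... | t , σ = t , read1 σ
admissible⇒run-pending {2 ∷ ds} α z with z 1 (s≤s z≤n) refl
... | suc _ , _ , s≤s () , _
admissible⇒run-pending {suc (suc (suc _)) ∷ ds} (s≤s (s≤s ()) ∷ _ , _) _

runBound : Mode → ℕ → ℕ
runBound free    K = u (suc K)
runBound pending K = v K

reversedValue-bound : ∀ {s ds t} → Run s ds t → ∀ K → length ds ≤ K → reversedValue (suc K) ds < runBound s K
reversedValue-bound {free}    [] K _ = u-pos K
reversedValue-bound {pending} [] K _ = v-pos K
reversedValue-bound {s} (read0 σ) (suc K) (s≤s len) =
  <-≤-trans (reversedValue-bound σ K len) (free≤ s)
  where
  free≤ : ∀ s → u (suc K) ≤ runBound s (suc K)
  free≤ free    = u-suc-mono K
  free≤ pending = u≤v K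
reversedValue-bound (read1 {free} {ds} σ) (suc K) (s≤s len) = begin-strict
  1 * u (suc K) + reversedValue (suc K) ds  <⟨ +-monoʳ-< (1 * u (suc K)) (<-≤-trans (reversedValue-bound σ K len) (u≤v K)) ⟩
  1 * u (suc K) + v (suc K)                 ≡⟨ sym (u-suc-suc≡1*u+v K) ⟩
  u (suc (suc K))                           ∎
  where open ≤-Reasoning
reversedValue-bound (read1 {pending} {ds} σ) (suc K) (s≤s len) = begin-strict
  1 * u (suc K) + reversedValue (suc K) ds  <⟨ +-monoʳ-< (1 * u (suc K)) (reversedValue-bound σ K len) ⟩
  1 * u (suc K) + v K                       ≡⟨ sym (v-suc≡1*u+v K) ⟩
  v (suc K)                                 ∎
  where open ≤-Reasoning
reversedValue-bound (read2 {ds} σ) (suc K) (s≤s len) = begin-strict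
  2 * u (suc K) + reversedValue (suc K) ds  <⟨ +-monoʳ-< (2 * u (suc K)) (reversedValue-bound σ K len) ⟩
  2 * u (suc K) + v K                       ≡⟨ sym (u-suc-suc K) ⟩
  u (suc (suc K))                           ∎
  where open ≤-Reasoning

Fits : ℕ → List ℕ → Set
Fits K w = Accepted w × length w ≤ K

fits-drop : ∀ {K w} i → Fits K w → Fits K (drop i w)
fits-drop {K} {w} i (α , len) =
  accepted-drop i α , ≤-trans (≤-reflexive (length-drop i w)) (≤-trans (m∸n≤m (length w) i) len)

-- Shifting down as a floor map

/-unique : ∀ n d q .{{_ : NonZero d}} → q * d ≤ n → n < suc q * d → n / d ≡ q
/-unique n d q lower upper = ≤-antisym (<⇒≤pred (m<n*o⇒m/o<n upper))
  (subst (_≤ n / d) (m*n/n≡m q d) (/-monoˡ-≤ d lower))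

/-superadditive : ∀ x y d .{{_ : NonZero d}} → x / d + y / d ≤ (x + y) / d
/-superadditive x y d = subst (_≤ (x + y) / d) (m*n/n≡m (x / d + y / d) d)
  (/-monoˡ-≤ d (subst (_≤ x + y) (sym (*-distribʳ-+ d (x / d) (y / d)))
    (+-mono-≤ (m/n*n≤m x d) (m/n*n≤m y d))))

/-subadditive : ∀ x y d .{{_ : NonZero d}} → (x + y) / d ≤ suc (x / d + y / d)
/-subadditive x y d = <⇒≤pred (m<n*o⇒m/o<n (subst (x + y <_) (identity (x / d) (y / d) d)
  (+-mono-< (below-next x) (below-next y))))
  where
  below-next : ∀ x → x < suc (x / d) * d
  below-next x = subst (_< suc (x / d) * d) (sym (m≡m%n+[m/n]*n x d)) (+-monoˡ-< (x / d * d) (m%n<n x d))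
  identity : ∀ a b d → suc a * d + suc b * d ≡ suc (suc (a + b)) * d
  identity = solve-∀

floorShift : ℕ → ℕ → ℕ
floorShift K N = (N * u K / u (suc K)) {{u-nonZero K}}

floorShift-tail : ∀ {K w} → Fits K w → shifted 1 w ≡ floorShift K (value w)
floorShift-tail {K} {w} ((_ , σ) , len) = sym (/-unique (value w * u K) (u (suc K)) (shifted 1 w) {{u-nonZero K}}
  (subst (q * U ≤_) (sym tail-identity) (m≤m+n (q * U) R))
  (subst (_< suc q * U) (sym tail-identity) (subst (q * U + R <_) (+-comm (q * U) U)
    (+-monoʳ-< (q * U) (reversedValue-bound σ K len)))))
  where
  q = shifted 1 w
  U = u (suc K)
  R = reversedValue (suc K) w
  tail-identity : value w * u K ≡ q * U + R
  tail-identity = value-tail w K (m≤n⇒m≤1+n len)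

shifted-suc : ∀ {K w} → Fits K w → ∀ i → shifted (suc i) w ≡ floorShift K (shifted i w)
shifted-suc {K} {w} fits i = trans (cong value drop-suc) (floorShift-tail (fits-drop i fits))
  where
  drop-suc : drop (suc i) w ≡ drop 1 (drop i w)
  drop-suc = trans (cong (λ n → drop n w) (+-comm 1 i)) (sym (drop-drop i 1 w))

floorShift-mono : ∀ K {x y} → x ≤ y → floorShift K x ≤ floorShift K y
floorShift-mono K x≤y = /-monoˡ-≤ (u (suc K)) {{u-nonZero K}} (*-monoˡ-≤ (u K) x≤y)

floorShift-superadditive : ∀ K x y → floorShift K x + floorShift K y ≤ floorShift K (x + y)
floorShift-superadditive K x y rewrite *-distribʳ-+ (u K) x y =
  /-superadditive (x * u K) (y * u K) (u (suc K)) {{u-nonZero K}}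

floorShift-subadditive : ∀ K x y → floorShift K (x + y) ≤ suc (floorShift K x + floorShift K y)
floorShift-subadditive K x y rewrite *-distribʳ-+ (u K) x y =
  /-subadditive (x * u K) (y * u K) (u (suc K)) {{u-nonZero K}}

floorShift-u : ∀ k → floorShift (suc k) (u (suc k)) ≡ u k
floorShift-u k = /-unique (U₁ * U₁) U₂ (u k) {{u-nonZero (suc k)}} lower upper
  where
  U₁ = u (suc k)
  U₂ = u (suc (suc k))
  lower : u k * U₂ ≤ U₁ * U₁
  lower = subst (u k * U₂ ≤_) (sym (u-cassini k)) (m≤m+n (u k * U₂) 1)
  upper : U₁ * U₁ < suc (u k) * U₂
  upper = begin-strict
    U₁ * U₁        ≡⟨ u-cassini k ⟩
    u k * U₂ + 1   <⟨ +-monoʳ-< (u k * U₂) (<-≤-trans (s≤s (s≤s z≤n)) (n≤u (suc (suc k)))) ⟩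
    u k * U₂ + U₂  ≡⟨ +-comm (u k * U₂) U₂ ⟩
    suc (u k) * U₂ ∎
    where open ≤-Reasoning

shifted-superadditive : ∀ {K x m y} → Fits K x → Fits K m → Fits K y →
  shifted 0 x + shifted 0 m ≤ shifted 0 y → ∀ i → shifted i x + shifted i m ≤ shifted i y
shifted-superadditive fx fm fy base zero = base
shifted-superadditive {K} {x} {m} {y} fx fm fy base (suc i)
  rewrite shifted-suc fx i | shifted-suc fm i | shifted-suc fy i =
  ≤-trans (floorShift-superadditive K (shifted i x) (shifted i m))
          (floorShift-mono K (shifted-superadditive fx fm fy base i))

-- Greedy expansions

leading remainder : ℕ → ℕ → ℕ
leading   K N = (N / u (suc K)) {{u-nonZero K}}
remainder K N = (N % u (suc K)) {{u-nonZero K}}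

greedy : ℕ → ℕ → List ℕ
greedy zero    N = []
greedy (suc K) N = greedy K (remainder K N) ++ leading K N ∷ []

data GreedyStep (K N : ℕ) : List ℕ → Set where
  split : ∀ r d → r < u (suc K) → r + d * u (suc K) ≡ N → GreedyStep K N (greedy K r ++ d ∷ [])

greedy-step : ∀ K N → GreedyStep K N (greedy (suc K) N)
greedy-step K N = split (remainder K N) (leading K N)
  (m%n<n N (u (suc K)) {{u-nonZero K}}) (sym (m≡m%n+[m/n]*n N (u (suc K)) {{u-nonZero K}}))

split-remainder-< : ∀ r d U {N b} → r + d * U ≡ N → N < d * U + b → r < b
split-remainder-< r d U {b = b} refl N< = +-cancelˡ-< (d * U) r b (subst (_< d * U + b) (+-comm r (d * U)) N<)

split-≤ : ∀ r d U {N b w} → r + d * U ≡ N → d * U + b ≤ N + w → b ≤ r + w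
split-≤ r d U {b = b} {w = w} refl bound≤ =
  +-cancelˡ-≤ (d * U) b (r + w) (subst (d * U + b ≤_) (identity r (d * U) w) bound≤)
  where
  identity : ∀ r x w → r + x + w ≡ x + (r + w)
  identity = solve-∀

split-leading-< : ∀ r d U c {N} → r + d * U ≡ N → N < c * U → d < c
split-leading-< r d U c refl N< = *-cancelʳ-< U d c (≤-<-trans (m≤n+m (d * U) r) N<)

greedy-length : ∀ K N → length (greedy K N) ≡ K
greedy-length zero N = refl
greedy-length (suc K) N =
  trans (length-++ (greedy K (remainder K N))) (trans (cong (_+ 1) (greedy-length K _)) (+-comm K 1))

greedy-value : ∀ K N → N < u (suc K) → value (greedy K N) ≡ N
greedy-value zero zero _ = refl
greedy-value zero (suc N) (s≤s ())
greedy-value (suc K) N _ = from-step (greedy-step K N)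
  where
  from-step : ∀ {g} → GreedyStep K N g → value g ≡ N
  from-step (split r d r< refl) = begin
    value (greedy K r ++ d ∷ [])                                  ≡⟨ valueFrom-++ 0 (greedy K r) (d ∷ []) ⟩
    value (greedy K r) + valueFrom (length (greedy K r)) (d ∷ []) ≡⟨ cong₂ (λ a j → a + valueFrom j (d ∷ []))
                                                                            (greedy-value K r r<) (greedy-length K r) ⟩
    r + (d * u (suc K) + 0)                                       ≡⟨ cong (_+_ r) (+-identityʳ (d * u (suc K))) ⟩
    r + d * u (suc K)                                             ∎
    where open ≡-Reasoning

greedy-accepted : ∀ K N → N < u (suc K) → Accepted (greedy K N)
greedy-free     : ∀ K N → N < v K → Run free (greedy K N) free

greedy-accepted zero N _ = free , []
greedy-accepted (suc K) N N< = from-step (greedy-step K N)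
  where
  from-step : ∀ {g} → GreedyStep K N g → Accepted g
  from-step (split r 0 r< _) with greedy-accepted K r r<
  ... | _ , σ = free , Run-++ σ (read0 [])
  from-step (split r 1 r< _) with greedy-accepted K r r<
  ... | t , σ = t , Run-++ σ (read1 [])
  from-step (split r 2 _ eq) =
    pending , Run-++ (greedy-free K r (split-remainder-< r 2 (u (suc K)) eq (subst (N <_) (u-suc-suc K) N<))) (read2 [])
  from-step (split r (suc (suc (suc d))) _ eq)
    with split-leading-< r (suc (suc (suc d))) (u (suc K)) 3 eq (<-≤-trans N< (u≤3u K))
  ... | s≤s (s≤s (s≤s ()))

greedy-free zero N _ = []
greedy-free (suc K) N N< = from-step (greedy-step K N)
  where
  from-step : ∀ {g} → GreedyStep K N g → Run free g free
  from-step (split r 0 r< _) = Run-++ (proj₂ (greedy-accepted K r r<)) (read0 [])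
  from-step (split r 1 _ eq) =
    Run-++ (greedy-free K r (split-remainder-< r 1 (u (suc K)) eq (subst (N <_) (v-suc≡1*u+v K) N<))) (read1 [])
  from-step (split r (suc (suc d)) _ eq)
    with split-leading-< r (suc (suc d)) (u (suc K)) 2 eq (<-≤-trans N< (v≤2u K))
  ... | s≤s (s≤s ())

toℚᵘ-/ : ∀ a b .{{_ : NonZero b}} → toℚᵘ (+ a ℚ./ b) ℚᵘ.≃ ℚᵘ.mkℚᵘ (+ a) (pred b)
toℚᵘ-/ a (suc b) = ℚ.toℚᵘ-fromℚᵘ (ℚᵘ.mkℚᵘ (+ a) b)

/-mono-≤ : ∀ a b c d .{{_ : NonZero b}} .{{_ : NonZero d}} → a * d ≤ c * b → + a ℚ./ b ℚ.≤ + c ℚ./ d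
/-mono-≤ a b@(suc _) c d@(suc _) ad≤cb = ℚ.toℚᵘ-cancel-≤
  (ℚᵘ.≤-respˡ-≃ (ℚᵘ.≃-sym (toℚᵘ-/ a b)) (ℚᵘ.≤-respʳ-≃ (ℚᵘ.≃-sym (toℚᵘ-/ c d))
    (ℚᵘ.*≤* (subst₂ ℤ._≤_ (ℤ.pos-* a d) (ℤ.pos-* c b) (ℤ.+≤+ ad≤cb)))))

/-+ : ∀ a b c d .{{_ : NonZero b}} .{{_ : NonZero d}} →
      + a ℚ./ b ℚ.+ + c ℚ./ d ≡ (+ (a * d + c * b) ℚ./ (b * d)) {{m*n≢0 b d}}
/-+ a b@(suc _) c d@(suc _) = ℚ.toℚᵘ-injective (ℚᵘ.≃-trans (ℚ.toℚᵘ-homo-+ (+ a ℚ./ b) (+ c ℚ./ d))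
  (ℚᵘ.≃-trans (ℚᵘ.+-cong (toℚᵘ-/ a b) (toℚᵘ-/ c d))
  (ℚᵘ.≃-trans (ℚᵘ.≃-reflexive (cong (λ n → ℚᵘ.mkℚᵘ n (pred (b * d))) numerator))
    (ℚᵘ.≃-sym (toℚᵘ-/ _ (b * d))))))
  where
  numerator : + a ℤ.* + d ℤ.+ + c ℤ.* + b ≡ + (a * d + c * b)
  numerator = sym (trans (ℤ.pos-+ (a * d) (c * b)) (cong₂ ℤ._+_ (ℤ.pos-* a d) (ℤ.pos-* c b)))

/-* : ∀ a b c d .{{_ : NonZero b}} .{{_ : NonZero d}} →
      (+ a ℚ./ b) ℚ.* (+ c ℚ./ d) ≡ (+ (a * c) ℚ./ (b * d)) {{m*n≢0 b d}}
/-* a b@(suc _) c d@(suc _) = ℚ.toℚᵘ-injective (ℚᵘ.≃-trans (ℚ.toℚᵘ-homo-* (+ a ℚ./ b) (+ c ℚ./ d))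
  (ℚᵘ.≃-trans (ℚᵘ.*-cong (toℚᵘ-/ a b) (toℚᵘ-/ c d))
  (ℚᵘ.≃-trans (ℚᵘ.≃-reflexive (cong (λ n → ℚᵘ.mkℚᵘ n (pred (b * d))) (sym (ℤ.pos-* a c))))
    (ℚᵘ.≃-sym (toℚᵘ-/ _ (b * d))))))

ι : ℕ → ℚ
ι n = + n ℚ./ 1

ι-+ : ∀ m n → ι (m + n) ≡ ι m ℚ.+ ι n
ι-+ m n = sym (trans (/-+ m 1 n 1) (cong (λ k → + k ℚ./ 1) (cong₂ _+_ (*-identityʳ m) (*-identityʳ n))))

ι-* : ∀ m n → ι (m * n) ≡ ι m ℚ.* ι n
ι-* m n = sym (/-* m 1 n 1)

ι-mono : ∀ {m n} → m ≤ n → ι m ℚ.≤ ι n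
ι-mono {m} {n} m≤n = /-mono-≤ m 1 n 1 (*-monoˡ-≤ 1 m≤n)

ι-scales-/ : ∀ a b .{{_ : NonZero b}} → ι a ℚ.* (+ 1 ℚ./ b) ≡ + a ℚ./ b
ι-scales-/ a b = trans (/-* a 1 1 b) (ℚ./-cong {{m*n≢0 1 b}} (cong +_ (*-identityʳ a)) (*-identityˡ b))

/-nonneg : ∀ a b .{{_ : NonZero b}} → 0ℚ ℚ.≤ + a ℚ./ b
/-nonneg a b = /-mono-≤ 0 1 a b z≤n

1/-antitone : ∀ m n .{{_ : NonZero m}} .{{_ : NonZero n}} → m ≤ n → + 1 ℚ./ n ℚ.≤ + 1 ℚ./ m
1/-antitone m n m≤n = /-mono-≤ 1 n 1 m (subst₂ _≤_ (sym (*-identityˡ m)) (sym (*-identityˡ n)) m≤n)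

1/-+-1/ : ∀ a b .{{_ : NonZero a}} .{{_ : NonZero b}} →
          + 1 ℚ./ a ℚ.+ + 1 ℚ./ b ≡ (+ (b + a) ℚ./ (a * b)) {{m*n≢0 a b}}
1/-+-1/ a b = trans (/-+ 1 a 1 b) (ℚ./-cong {{m*n≢0 a b}} {{m*n≢0 a b}} (cong +_ (cong₂ _+_ (*-identityˡ b) (*-identityˡ a))) refl)

ℚ-ring : AlmostCommutativeRing _ _
ℚ-ring = fromCommutativeRing ℚ.+-*-commutativeRing (λ x → dec⇒maybe (0ℚ ℚ.≟ x))

p+q≤r⇒q≤r-p : ∀ p q r → p ℚ.+ q ℚ.≤ r → q ℚ.≤ r ℚ.- p
p+q≤r⇒q≤r-p p q r p+q≤r = subst (ℚ._≤ r ℚ.- p) (identity p q) (ℚ.+-monoˡ-≤ (ℚ.- p) p+q≤r)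
  where
  identity : ∀ p q → p ℚ.+ q ℚ.- p ≡ q
  identity = Ring.solve-∀ ℚ-ring

q≤p+q : ∀ {p} q → 0ℚ ℚ.≤ p → q ℚ.≤ p ℚ.+ q
q≤p+q {p} q 0≤p = subst (ℚ._≤ p ℚ.+ q) (ℚ.+-identityˡ q) (ℚ.+-monoˡ-≤ q 0≤p)

q≤q+p : ∀ {p} q → 0ℚ ℚ.≤ p → q ℚ.≤ q ℚ.+ p
q≤q+p {p} q 0≤p = subst (ℚ._≤ q ℚ.+ p) (ℚ.+-identityʳ q) (ℚ.+-monoʳ-≤ q 0≤p)

p≤∣q∣ : ∀ {p q} → 0ℚ ℚ.≤ p → p ℚ.≤ q → p ℚ.≤ ℚ.∣ q ∣
p≤∣q∣ {p} 0≤p p≤q = subst (p ℚ.≤_) (sym (ℚ.0≤p⇒∣p∣≡p (ℚ.≤-trans 0≤p p≤q))) p≤q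

∣p-q∣≡∣q-p∣ : ∀ p q → ℚ.∣ p ℚ.- q ∣ ≡ ℚ.∣ q ℚ.- p ∣
∣p-q∣≡∣q-p∣ p q = trans (cong ℚ.∣_∣ (identity p q)) (ℚ.∣-p∣≡∣p∣ (q ℚ.- p))
  where
  identity : ∀ p q → p ℚ.- q ≡ ℚ.- (q ℚ.- p)
  identity = Ring.solve-∀ ℚ-ring

weight : ℕ → ℚ
weight k = (+ 1 ℚ./ u (suc k)) {{u-nonZero k}}

vWeight : ℕ → ℚ
vWeight k = (+ 1 ℚ./ v k) {{v-nonZero k}}

weight-nonneg : ∀ k → 0ℚ ℚ.≤ weight k
weight-nonneg k = /-nonneg 1 (u (suc k)) {{u-nonZero k}}

weight-antitone : ∀ k → weight (suc k) ℚ.≤ weight k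
weight-antitone k = 1/-antitone (u (suc k)) (u (suc (suc k))) {{u-nonZero k}} {{u-nonZero (suc k)}} (u-suc-mono k)

fFrom-uncons : ∀ k w → fFrom k w ≡ ι (digit w 1) ℚ.* weight k ℚ.+ fFrom (suc k) (drop 1 w)
fFrom-uncons k [] = sym (trans (ℚ.+-identityʳ _) (ℚ.*-zeroˡ (weight k)))
fFrom-uncons k (d ∷ ds) = cong (ℚ._+ fFrom (suc k) ds) (sym (ι-scales-/ d (u (suc k)) {{u-nonZero k}}))

fFrom-++ : ∀ k xs ys → fFrom k (xs ++ ys) ≡ fFrom k xs ℚ.+ fFrom (k + length xs) ys
fFrom-++ k [] ys = sym (trans (ℚ.+-identityˡ _) (cong (λ j → fFrom j ys) (+-identityʳ k)))
fFrom-++ k (x ∷ xs) ys rewrite fFrom-++ (suc k) xs ys | +-suc k (length xs) =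
  sym (ℚ.+-assoc ((+ x ℚ./ u (suc k)) {{u-nonZero k}}) (fFrom (suc k) xs) _)

fFrom-zeros : ∀ k z ys → fFrom k (replicate z 0 ++ ys) ≡ fFrom (k + z) ys
fFrom-zeros k zero ys = cong (λ j → fFrom j ys) (sym (+-identityʳ k))
fFrom-zeros k (suc z) ys rewrite +-suc k z =
  trans (cong (ℚ._+ fFrom (suc k) (replicate z 0 ++ ys)) (ℚ.0/n≡0 (u (suc k)) {{u-nonZero k}}))
        (trans (ℚ.+-identityˡ _) (fFrom-zeros (suc k) z ys))

fFrom-nonneg : ∀ k w → 0ℚ ℚ.≤ fFrom k w
fFrom-nonneg k [] = ℚ.≤-refl
fFrom-nonneg k (d ∷ ds) = ℚ.+-mono-≤ (/-nonneg d (u (suc k)) {{u-nonZero k}}) (fFrom-nonneg (suc k) ds)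

-- Summation by parts

-- With a_i = shifted i w, fFrom k w = headTerms k w + Σ_{i ≥ 2} a_i · curvature (k + i − 2); tailTerms k w is that sum.
headTerms : ℕ → List ℕ → ℚ
headTerms k w = ι (shifted 0 w) ℚ.* weight k ℚ.+ ι (shifted 1 w) ℚ.* (weight (suc k) ℚ.- ι 3 ℚ.* weight k)

tailTerms : ℕ → List ℕ → ℚ
tailTerms k w = fFrom k w ℚ.- headTerms k w

curvature : ℕ → ℚ
curvature k = weight k ℚ.- ι 3 ℚ.* weight (suc k) ℚ.+ weight (suc (suc k))

tailTerms-[] : ∀ k → tailTerms k [] ≡ 0ℚ
tailTerms-[] k = identity (weight k) (weight (suc k) ℚ.- ι 3 ℚ.* weight k)
  where
  identity : ∀ a b → 0ℚ ℚ.- (0ℚ ℚ.* a ℚ.+ 0ℚ ℚ.* b) ≡ 0ℚ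
  identity = Ring.solve-∀ ℚ-ring

ι-first-digit≡second-difference : ∀ w → ι (digit w 1) ≡ ι (shifted 0 w) ℚ.+ ι (shifted 2 w) ℚ.- ι 3 ℚ.* ι (shifted 1 w)
ι-first-digit≡second-difference w = trans (sym (identity (ι (digit w 1)) (ι 3 ℚ.* ι (shifted 1 w))))
  (cong (ℚ._- ι 3 ℚ.* ι (shifted 1 w)) (begin
    ι (digit w 1) ℚ.+ ι 3 ℚ.* ι (shifted 1 w) ≡⟨ cong (ℚ._+_ (ι (digit w 1))) (sym (ι-* 3 (shifted 1 w))) ⟩
    ι (digit w 1) ℚ.+ ι (3 * shifted 1 w)     ≡⟨ sym (ι-+ (digit w 1) _) ⟩
    ι (digit w 1 + 3 * shifted 1 w)           ≡⟨ cong ι (first-digit≡second-difference w) ⟩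
    ι (shifted 0 w + shifted 2 w)             ≡⟨ ι-+ (shifted 0 w) (shifted 2 w) ⟩
    ι (shifted 0 w) ℚ.+ ι (shifted 2 w)       ∎))
  where
  open ≡-Reasoning
  identity : ∀ a b → a ℚ.+ b ℚ.- b ≡ a
  identity = Ring.solve-∀ ℚ-ring

tailTerms-step : ∀ k w → tailTerms k w ≡ ι (shifted 2 w) ℚ.* curvature k ℚ.+ tailTerms (suc k) (drop 1 w)
tailTerms-step k w = begin
  fFrom k w ℚ.- headTerms k w
    ≡⟨ cong (ℚ._- headTerms k w) (fFrom-uncons k w) ⟩
  ι (digit w 1) ℚ.* W₀ ℚ.+ rest ℚ.- headTerms k w
    ≡⟨ cong (λ d → d ℚ.* W₀ ℚ.+ rest ℚ.- headTerms k w) (ι-first-digit≡second-difference w) ⟩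
  (a₀ ℚ.+ a₂ ℚ.- three ℚ.* a₁) ℚ.* W₀ ℚ.+ rest ℚ.- (a₀ ℚ.* W₀ ℚ.+ a₁ ℚ.* (W₁ ℚ.- three ℚ.* W₀))
    ≡⟨ identity a₀ a₁ a₂ three W₀ W₁ W₂ rest ⟩
  a₂ ℚ.* curvature k ℚ.+ (rest ℚ.- (a₁ ℚ.* W₁ ℚ.+ a₂ ℚ.* (W₂ ℚ.- three ℚ.* W₁)))
    ≡⟨ cong₂ (λ b c → a₂ ℚ.* curvature k ℚ.+ (rest ℚ.- (ι b ℚ.* W₁ ℚ.+ ι c ℚ.* (W₂ ℚ.- three ℚ.* W₁))))
             (sym (shifted-tail 0 w)) (sym (shifted-tail 1 w)) ⟩
  a₂ ℚ.* curvature k ℚ.+ tailTerms (suc k) (drop 1 w) ∎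
  where
  open ≡-Reasoning
  a₀ = ι (shifted 0 w)
  a₁ = ι (shifted 1 w)
  a₂ = ι (shifted 2 w)
  three = ι 3
  W₀ = weight k
  W₁ = weight (suc k)
  W₂ = weight (suc (suc k))
  rest = fFrom (suc k) (drop 1 w)
  identity : ∀ a₀ a₁ a₂ c W₀ W₁ W₂ r →
    (a₀ ℚ.+ a₂ ℚ.- c ℚ.* a₁) ℚ.* W₀ ℚ.+ r ℚ.- (a₀ ℚ.* W₀ ℚ.+ a₁ ℚ.* (W₁ ℚ.- c ℚ.* W₀))
      ≡ a₂ ℚ.* (W₀ ℚ.- c ℚ.* W₁ ℚ.+ W₂) ℚ.+ (r ℚ.- (a₁ ℚ.* W₁ ℚ.+ a₂ ℚ.* (W₂ ℚ.- c ℚ.* W₁)))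
  identity = Ring.solve-∀ ℚ-ring

curvature-nonneg : ∀ k → 0ℚ ℚ.≤ curvature k
curvature-nonneg k = subst (0ℚ ℚ.≤_) (identity (weight k) (ι 3 ℚ.* weight (suc k)) (weight (suc (suc k))))
  (p+q≤r⇒q≤r-p _ 0ℚ _ (subst (ℚ._≤ weight k ℚ.+ weight (suc (suc k))) (sym (ℚ.+-identityʳ _)) convex))
  where
  U₀ = u (suc k)
  U₁ = u (suc (suc k))
  U₂ = u (suc (suc (suc k)))
  identity : ∀ a b c → a ℚ.+ c ℚ.- b ≡ a ℚ.- b ℚ.+ c
  identity = Ring.solve-∀ ℚ-ring
  cross-multiplied : 3 * (U₀ * U₂) ≤ (U₂ + U₀) * U₁
  cross-multiplied = begin
    3 * (U₀ * U₂)      ≤⟨ *-monoʳ-≤ 3 (m≤m+n (U₀ * U₂) 1) ⟩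
    3 * (U₀ * U₂ + 1)  ≡⟨ cong (3 *_) (sym (u-cassini (suc k))) ⟩
    3 * (U₁ * U₁)      ≡⟨ sym (*-assoc 3 U₁ U₁) ⟩
    3 * U₁ * U₁        ≡⟨ cong (_* U₁) (sym (u-three-term (suc k))) ⟩
    (U₂ + U₀) * U₁     ∎
    where open ≤-Reasoning
  convex : ι 3 ℚ.* weight (suc k) ℚ.≤ weight k ℚ.+ weight (suc (suc k))
  convex = subst₂ ℚ._≤_ (sym (ι-scales-/ 3 U₁ {{u-nonZero (suc k)}}))
    (sym (1/-+-1/ U₀ U₂ {{u-nonZero k}} {{u-nonZero (suc (suc k))}}))
    (/-mono-≤ 3 U₁ (U₂ + U₀) (U₀ * U₂) {{u-nonZero (suc k)}}
      {{m*n≢0 U₀ U₂ {{u-nonZero k}} {{u-nonZero (suc (suc k))}}}} cross-multiplied)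

length-drop-1 : ∀ {L} (w : List ℕ) → length w ≤ suc L → length (drop 1 w) ≤ L
length-drop-1 []      _         = z≤n
length-drop-1 (_ ∷ _) (s≤s len) = len

tailTerms-superadditive : ∀ L k x m y → length x ≤ L → length m ≤ L → length y ≤ L →
  (∀ i → shifted (2 + i) x + shifted (2 + i) m ≤ shifted (2 + i) y) →
  tailTerms k x ℚ.+ tailTerms k m ℚ.≤ tailTerms k y
tailTerms-superadditive zero k [] [] [] _ _ _ _ =
  ℚ.≤-reflexive (trans (cong₂ ℚ._+_ (tailTerms-[] k) (tailTerms-[] k)) (sym (tailTerms-[] k)))
tailTerms-superadditive (suc L) k x m y lx lm ly below = begin
  tailTerms k x ℚ.+ tailTerms k m
    ≡⟨ cong₂ ℚ._+_ (tailTerms-step k x) (tailTerms-step k m) ⟩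
  ι x₂ ℚ.* ρ ℚ.+ tailTerms (suc k) (drop 1 x) ℚ.+ (ι m₂ ℚ.* ρ ℚ.+ tailTerms (suc k) (drop 1 m))
    ≡⟨ identity (ι x₂) (ι m₂) ρ _ _ ⟩
  (ι x₂ ℚ.+ ι m₂) ℚ.* ρ ℚ.+ (tailTerms (suc k) (drop 1 x) ℚ.+ tailTerms (suc k) (drop 1 m))
    ≤⟨ ℚ.+-mono-≤ (ℚ.*-monoʳ-≤-nonNeg ρ {{ℚ.nonNegative (curvature-nonneg k)}}
                     (subst (ℚ._≤ ι y₂) (ι-+ x₂ m₂) (ι-mono (below 0))))
                  (tailTerms-superadditive L (suc k) (drop 1 x) (drop 1 m) (drop 1 y)
                     (length-drop-1 x lx) (length-drop-1 m lm) (length-drop-1 y ly) below′) ⟩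
  ι y₂ ℚ.* ρ ℚ.+ tailTerms (suc k) (drop 1 y)
    ≡⟨ sym (tailTerms-step k y) ⟩
  tailTerms k y ∎
  where
  open ℚ.≤-Reasoning
  ρ = curvature k
  x₂ = shifted 2 x
  m₂ = shifted 2 m
  y₂ = shifted 2 y
  below′ : ∀ i → shifted (2 + i) (drop 1 x) + shifted (2 + i) (drop 1 m) ≤ shifted (2 + i) (drop 1 y)
  below′ i rewrite shifted-tail (2 + i) x | shifted-tail (2 + i) m | shifted-tail (2 + i) y = below (suc i)
  identity : ∀ a b r s t → a ℚ.* r ℚ.+ s ℚ.+ (b ℚ.* r ℚ.+ t) ≡ (a ℚ.+ b) ℚ.* r ℚ.+ (s ℚ.+ t)
  identity = Ring.solve-∀ ℚ-ring

headTerms-additive : ∀ k x m y → shifted 0 x + shifted 0 m ≡ shifted 0 y → shifted 1 x + shifted 1 m ≡ shifted 1 y →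
  headTerms k x ℚ.+ headTerms k m ≡ headTerms k y
headTerms-additive k x m y e₀ e₁ = begin
  headTerms k x ℚ.+ headTerms k m
    ≡⟨ identity (ι (shifted 0 x)) (ι (shifted 0 m)) (ι (shifted 1 x)) (ι (shifted 1 m)) (weight k) B ⟩
  (ι (shifted 0 x) ℚ.+ ι (shifted 0 m)) ℚ.* weight k ℚ.+ (ι (shifted 1 x) ℚ.+ ι (shifted 1 m)) ℚ.* B
    ≡⟨ cong₂ (λ a b → a ℚ.* weight k ℚ.+ b ℚ.* B)
         (trans (sym (ι-+ (shifted 0 x) _)) (cong ι e₀)) (trans (sym (ι-+ (shifted 1 x) _)) (cong ι e₁)) ⟩
  headTerms k y ∎
  where
  open ≡-Reasoning
  B = weight (suc k) ℚ.- ι 3 ℚ.* weight k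
  identity : ∀ a₀ b₀ a₁ b₁ W B → a₀ ℚ.* W ℚ.+ a₁ ℚ.* B ℚ.+ (b₀ ℚ.* W ℚ.+ b₁ ℚ.* B) ≡ (a₀ ℚ.+ b₀) ℚ.* W ℚ.+ (a₁ ℚ.+ b₁) ℚ.* B
  identity = Ring.solve-∀ ℚ-ring

fDigits-superadditive : ∀ {K x m y} → Fits K x → Fits K m → Fits K y →
  shifted 0 x + shifted 0 m ≡ shifted 0 y → shifted 1 x + shifted 1 m ≡ shifted 1 y →
  fDigits x ℚ.+ fDigits m ℚ.≤ fDigits y
fDigits-superadditive {K} {x} {m} {y} fx@(_ , lx) fm@(_ , lm) fy@(_ , ly) e₀ e₁ = begin
  fDigits x ℚ.+ fDigits m
    ≡⟨ identity (fDigits x) (fDigits m) (headTerms 0 x) (headTerms 0 m) ⟩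
  (headTerms 0 x ℚ.+ headTerms 0 m) ℚ.+ (tailTerms 0 x ℚ.+ tailTerms 0 m)
    ≤⟨ ℚ.+-mono-≤ (ℚ.≤-reflexive (headTerms-additive 0 x m y e₀ e₁))
                  (tailTerms-superadditive K 0 x m y lx lm ly (λ i → shifted-superadditive fx fm fy (≤-reflexive e₀) (2 + i))) ⟩
  headTerms 0 y ℚ.+ tailTerms 0 y
    ≡⟨ identity′ (fDigits y) (headTerms 0 y) ⟩
  fDigits y ∎
  where
  open ℚ.≤-Reasoning
  identity : ∀ f g h k → f ℚ.+ g ≡ (h ℚ.+ k) ℚ.+ ((f ℚ.- h) ℚ.+ (g ℚ.- k))
  identity = Ring.solve-∀ ℚ-ring
  identity′ : ∀ f h → h ℚ.+ (f ℚ.- h) ≡ f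
  identity′ = Ring.solve-∀ ℚ-ring

-- Greedy expansions have large f

vWeight-suc+weight-suc≤weight : ∀ K → vWeight (suc K) ℚ.+ weight (suc K) ℚ.≤ weight K
vWeight-suc+weight-suc≤weight K =
  subst (ℚ._≤ weight K) (sym (1/-+-1/ V′ U′ {{v-nonZero (suc K)}} {{u-nonZero (suc K)}}))
    (/-mono-≤ (U′ + V′) (V′ * U′) 1 U {{m*n≢0 V′ U′ {{v-nonZero (suc K)}} {{u-nonZero (suc K)}}}} {{u-nonZero K}}
      (subst ((U′ + V′) * U ≤_) (trans (sym cross-identity) (sym (*-identityˡ (V′ * U′)))) (m≤m+n _ 1)))
  where
  U = u (suc K)
  U′ = u (suc (suc K))
  V′ = v (suc K)
  cross-identity : V′ * U′ ≡ (U′ + V′) * U + 1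
  cross-identity rewrite u-suc-suc K | v-suc K | u-suc K = modulo-cassini K 1 _ _ (identity (u K) (v K))
    where
    identity : ∀ a b → (b + a + b) * (2 * (b + a) + b) + 1 * (a * a + a * b + 1)
                     ≡ (2 * (b + a) + b + (b + a + b)) * (b + a) + 1 + 1 * (b * b)
    identity = solve-∀

vWeight+weight-suc≤2weight : ∀ K → vWeight K ℚ.+ weight (suc K) ℚ.≤ ι 2 ℚ.* weight K
vWeight+weight-suc≤2weight K =
  subst₂ ℚ._≤_ (sym (1/-+-1/ V U′ {{v-nonZero K}} {{u-nonZero (suc K)}})) (sym (ι-scales-/ 2 U {{u-nonZero K}}))
    (/-mono-≤ (U′ + V) (V * U′) 2 U {{m*n≢0 V U′ {{v-nonZero K}} {{u-nonZero (suc K)}}}} {{u-nonZero K}}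
      (subst ((U′ + V) * U ≤_) (sym cross-identity) (m≤m+n _ 2)))
  where
  U = u (suc K)
  U′ = u (suc (suc K))
  V = v K
  cross-identity : 2 * (V * U′) ≡ (U′ + V) * U + 2
  cross-identity rewrite u-suc-suc K | u-suc K = modulo-cassini K 2 _ _ (identity (u K) (v K))
    where
    identity : ∀ a b → 2 * (b * (2 * (b + a) + b)) + 2 * (a * a + a * b + 1)
                     ≡ (2 * (b + a) + b + b) * (b + a) + 2 + 2 * (b * b)
    identity = solve-∀

vWeight≤weight+vWeight-suc : ∀ K → vWeight K ℚ.≤ weight K ℚ.+ vWeight (suc K)
vWeight≤weight+vWeight-suc K =
  subst (vWeight K ℚ.≤_) (sym (1/-+-1/ U V′ {{u-nonZero K}} {{v-nonZero (suc K)}}))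
    (/-mono-≤ 1 V (V′ + U) (U * V′) {{v-nonZero K}} {{m*n≢0 U V′ {{u-nonZero K}} {{v-nonZero (suc K)}}}}
      (subst₂ _≤_ (sym (*-identityˡ (U * V′))) (sym cross-identity) (m≤m+n _ 1)))
  where
  U = u (suc K)
  V = v K
  V′ = v (suc K)
  cross-identity : (V′ + U) * V ≡ U * V′ + 1
  cross-identity rewrite v-suc K | u-suc K = modulo-cassini K 1 _ _ (identity (u K) (v K))
    where
    identity : ∀ a b → (b + a + b + (b + a)) * b + 1 * (a * a + a * b + 1)
                     ≡ (b + a) * (b + a + b) + 1 + 1 * (b * b)
    identity = solve-∀

fDigits-greedy-snoc : ∀ K r d → fDigits (greedy K r ++ d ∷ []) ≡ fDigits (greedy K r) ℚ.+ ι d ℚ.* weight K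
fDigits-greedy-snoc K r d = begin
  fDigits (greedy K r ++ d ∷ [])
    ≡⟨ fFrom-++ 0 (greedy K r) (d ∷ []) ⟩
  fDigits (greedy K r) ℚ.+ fFrom (length (greedy K r)) (d ∷ [])
    ≡⟨ cong (λ j → fDigits (greedy K r) ℚ.+ fFrom j (d ∷ [])) (greedy-length K r) ⟩
  fDigits (greedy K r) ℚ.+ fFrom K (d ∷ [])
    ≡⟨ cong (ℚ._+_ (fDigits (greedy K r))) (trans (ℚ.+-identityʳ _) (sym (ι-scales-/ d (u (suc K)) {{u-nonZero K}}))) ⟩
  fDigits (greedy K r) ℚ.+ ι d ℚ.* weight K ∎
  where open ≡-Reasoning

+-zero-digit : ∀ p K → p ℚ.+ ι 0 ℚ.* weight K ≡ p
+-zero-digit p K = trans (cong (ℚ._+_ p) (ℚ.*-zeroˡ (weight K))) (ℚ.+-identityʳ p)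

recip≤greedy : ∀ K N .{{_ : NonZero N}} → N < u (suc K) → + 1 ℚ./ N ℚ.≤ fDigits (greedy K N)
recip≤greedy zero N N<1 = ⊥-elim (<⇒≱ N<1 (>-nonZero⁻¹ N))
recip≤greedy (suc K) N N< = from-step (greedy-step K N)
  where
  from-step : ∀ {g} → GreedyStep K N g → + 1 ℚ./ N ℚ.≤ fDigits g
  from-step (split zero 0 _ eq) = ⊥-elim (<-irrefl eq (>-nonZero⁻¹ N))
  from-step (split (suc r) 0 r< eq) = begin
    + 1 ℚ./ N                                       ≡⟨ ℚ./-cong {+ 1} {N} refl (trans (sym eq) (+-identityʳ (suc r))) ⟩
    + 1 ℚ./ suc r                                   ≤⟨ recip≤greedy K (suc r) r< ⟩
    fDigits (greedy K (suc r))                      ≡⟨ sym (+-zero-digit _ K) ⟩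
    fDigits (greedy K (suc r)) ℚ.+ ι 0 ℚ.* weight K ≡⟨ sym (fDigits-greedy-snoc K (suc r) 0) ⟩
    fDigits (greedy K (suc r) ++ 0 ∷ [])            ∎
    where open ℚ.≤-Reasoning
  from-step (split r (suc d) _ eq) = begin
    + 1 ℚ./ N                                       ≤⟨ /-mono-≤ 1 N (suc d) U {{>-nonZero (≤-trans (u-pos K) U≤N)}} {{u-nonZero K}} cross-multiplied ⟩
    (+ suc d ℚ./ U) {{u-nonZero K}}                 ≡⟨ sym (ι-scales-/ (suc d) U {{u-nonZero K}}) ⟩
    ι (suc d) ℚ.* weight K                          ≤⟨ q≤p+q _ (fFrom-nonneg 0 (greedy K r)) ⟩
    fDigits (greedy K r) ℚ.+ ι (suc d) ℚ.* weight K ≡⟨ sym (fDigits-greedy-snoc K r (suc d)) ⟩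
    fDigits (greedy K r ++ suc d ∷ [])              ∎
    where
    open ℚ.≤-Reasoning
    U = u (suc K)
    U≤N : U ≤ N
    U≤N = ≤-trans (m≤m+n U (d * U)) (subst (suc d * U ≤_) eq (m≤n+m _ r))
    cross-multiplied : 1 * U ≤ suc d * N
    cross-multiplied = ≤-trans (≤-reflexive (*-identityˡ U)) (≤-trans U≤N (m≤m+n N (d * N)))

recip+weight≤greedy : ∀ K N w .{{_ : NonZero N}} .{{_ : NonZero w}} → N < u (suc K) → u (suc K) ≤ N + w →
  + 1 ℚ./ w ℚ.+ weight K ℚ.≤ fDigits (greedy K N)
recip≤greedy+vWeight : ∀ K r w .{{_ : NonZero w}} → r < v K → v K ≤ r + w →
  + 1 ℚ./ w ℚ.≤ fDigits (greedy K r) ℚ.+ vWeight K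

recip+weight≤greedy zero N w N<1 _ = ⊥-elim (<⇒≱ N<1 (>-nonZero⁻¹ N))
recip+weight≤greedy (suc K) N w N< U′≤N+w = from-step (greedy-step K N)
  where
  open ℚ.≤-Reasoning
  1/w = + 1 ℚ./ w
  from-step : ∀ {g} → GreedyStep K N g → 1/w ℚ.+ weight (suc K) ℚ.≤ fDigits g
  from-step (split zero 0 _ eq) = ⊥-elim (<-irrefl eq (>-nonZero⁻¹ N))
  from-step (split (suc r) 0 r< eq) = begin
    1/w ℚ.+ weight (suc K)                           ≤⟨ ℚ.+-monoʳ-≤ 1/w (weight-antitone K) ⟩
    1/w ℚ.+ weight K                                 ≤⟨ recip+weight≤greedy K (suc r) w r< U≤r+w ⟩
    fDigits (greedy K (suc r))                       ≡⟨ sym (+-zero-digit _ K) ⟩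
    fDigits (greedy K (suc r)) ℚ.+ ι 0 ℚ.* weight K  ≡⟨ sym (fDigits-greedy-snoc K (suc r) 0) ⟩
    fDigits (greedy K (suc r) ++ 0 ∷ [])             ∎
    where
    U≤r+w : u (suc K) ≤ suc r + w
    U≤r+w = ≤-trans (u-suc-mono K) (split-≤ (suc r) 0 (u (suc K)) eq U′≤N+w)
  from-step (split zero 1 _ eq) = begin
    1/w ℚ.+ weight (suc K)                           ≤⟨ ℚ.+-monoˡ-≤ (weight (suc K)) (1/-antitone (v (suc K)) w {{v-nonZero (suc K)}} V′≤w) ⟩
    vWeight (suc K) ℚ.+ weight (suc K)               ≤⟨ vWeight-suc+weight-suc≤weight K ⟩
    weight K                                         ≡⟨ sym (ℚ.*-identityˡ (weight K)) ⟩
    ι 1 ℚ.* weight K                                 ≤⟨ q≤p+q _ (fFrom-nonneg 0 (greedy K 0)) ⟩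
    fDigits (greedy K 0) ℚ.+ ι 1 ℚ.* weight K        ≡⟨ sym (fDigits-greedy-snoc K 0 1) ⟩
    fDigits (greedy K 0 ++ 1 ∷ [])                   ∎
    where
    V′≤w : v (suc K) ≤ w
    V′≤w = split-≤ 0 1 (u (suc K)) eq (subst (_≤ N + w) (u-suc-suc≡1*u+v K) U′≤N+w)
  from-step (split (suc r) 1 r< eq) = begin
    1/w ℚ.+ weight (suc K)                           ≤⟨ ℚ.+-monoʳ-≤ 1/w (weight-antitone K) ⟩
    1/w ℚ.+ weight K                                 ≤⟨ recip+weight≤greedy K (suc r) w r< U≤r+w ⟩
    fDigits (greedy K (suc r))                       ≤⟨ q≤q+p _ (subst (0ℚ ℚ.≤_) (sym (ℚ.*-identityˡ (weight K))) (weight-nonneg K)) ⟩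
    fDigits (greedy K (suc r)) ℚ.+ ι 1 ℚ.* weight K  ≡⟨ sym (fDigits-greedy-snoc K (suc r) 1) ⟩
    fDigits (greedy K (suc r) ++ 1 ∷ [])             ∎
    where
    U≤r+w : u (suc K) ≤ suc r + w
    U≤r+w = ≤-trans (u≤v K) (split-≤ (suc r) 1 (u (suc K)) eq (subst (_≤ N + w) (u-suc-suc≡1*u+v K) U′≤N+w))
  from-step (split r 2 _ eq) = begin
    1/w ℚ.+ weight (suc K)                           ≤⟨ ℚ.+-monoˡ-≤ (weight (suc K)) (recip≤greedy+vWeight K r w r<V V≤r+w) ⟩
    fDigits (greedy K r) ℚ.+ vWeight K ℚ.+ weight (suc K)   ≡⟨ ℚ.+-assoc (fDigits (greedy K r)) (vWeight K) (weight (suc K)) ⟩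
    fDigits (greedy K r) ℚ.+ (vWeight K ℚ.+ weight (suc K)) ≤⟨ ℚ.+-monoʳ-≤ (fDigits (greedy K r)) (vWeight+weight-suc≤2weight K) ⟩
    fDigits (greedy K r) ℚ.+ ι 2 ℚ.* weight K        ≡⟨ sym (fDigits-greedy-snoc K r 2) ⟩
    fDigits (greedy K r ++ 2 ∷ [])                   ∎
    where
    r<V : r < v K
    r<V = split-remainder-< r 2 (u (suc K)) eq (subst (N <_) (u-suc-suc K) N<)
    V≤r+w : v K ≤ r + w
    V≤r+w = split-≤ r 2 (u (suc K)) eq (subst (_≤ N + w) (u-suc-suc K) U′≤N+w)
  from-step (split r (suc (suc (suc d))) _ eq)
    with split-leading-< r (suc (suc (suc d))) (u (suc K)) 3 eq (<-≤-trans N< (u≤3u K))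
  ... | s≤s (s≤s (s≤s ()))

recip≤greedy+vWeight zero zero w _ 1≤w = ℚ.≤-trans (1/-antitone 1 w 1≤w) (q≤p+q _ ℚ.≤-refl)
recip≤greedy+vWeight zero (suc r) w (s≤s ()) _
recip≤greedy+vWeight (suc K) r w r< V′≤r+w = from-step (greedy-step K r)
  where
  open ℚ.≤-Reasoning
  1/w = + 1 ℚ./ w
  from-step : ∀ {g} → GreedyStep K r g → 1/w ℚ.≤ fDigits g ℚ.+ vWeight (suc K)
  from-step (split zero 0 _ eq) = begin
    1/w                                              ≤⟨ 1/-antitone (v (suc K)) w {{v-nonZero (suc K)}}
                                                          (subst (λ t → v (suc K) ≤ t + w) (sym eq) V′≤r+w) ⟩
    vWeight (suc K)                                  ≤⟨ q≤p+q _ (fFrom-nonneg 0 (greedy K 0 ++ 0 ∷ [])) ⟩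
    fDigits (greedy K 0 ++ 0 ∷ []) ℚ.+ vWeight (suc K) ∎
  from-step (split (suc r′) 0 r′< eq) = begin
    1/w                                              ≤⟨ q≤q+p _ (weight-nonneg K) ⟩
    1/w ℚ.+ weight K                                 ≤⟨ recip+weight≤greedy K (suc r′) w r′< U≤r+w ⟩
    fDigits (greedy K (suc r′))                      ≡⟨ sym (trans (fDigits-greedy-snoc K (suc r′) 0) (+-zero-digit _ K)) ⟩
    fDigits (greedy K (suc r′) ++ 0 ∷ [])            ≤⟨ q≤q+p _ (/-nonneg 1 (v (suc K)) {{v-nonZero (suc K)}}) ⟩
    fDigits (greedy K (suc r′) ++ 0 ∷ []) ℚ.+ vWeight (suc K) ∎
    where
    U≤r+w : u (suc K) ≤ suc r′ + w
    U≤r+w = ≤-trans (u≤v K) (split-≤ (suc r′) 0 (u (suc K)) eq V′≤r+w)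
  from-step (split r′ 1 _ eq) = begin
    1/w                                                    ≤⟨ recip≤greedy+vWeight K r′ w r′<V V≤r′+w ⟩
    fDigits (greedy K r′) ℚ.+ vWeight K                    ≤⟨ ℚ.+-monoʳ-≤ (fDigits (greedy K r′)) (vWeight≤weight+vWeight-suc K) ⟩
    fDigits (greedy K r′) ℚ.+ (weight K ℚ.+ vWeight (suc K)) ≡⟨ sym (ℚ.+-assoc (fDigits (greedy K r′)) (weight K) (vWeight (suc K))) ⟩
    fDigits (greedy K r′) ℚ.+ weight K ℚ.+ vWeight (suc K) ≡⟨ cong (ℚ._+ vWeight (suc K)) (sym (trans (fDigits-greedy-snoc K r′ 1)
                                                                (cong (ℚ._+_ (fDigits (greedy K r′))) (ℚ.*-identityˡ (weight K))))) ⟩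
    fDigits (greedy K r′ ++ 1 ∷ []) ℚ.+ vWeight (suc K)    ∎
    where
    r′<V : r′ < v K
    r′<V = split-remainder-< r′ 1 (u (suc K)) eq (subst (r <_) (v-suc≡1*u+v K) r<)
    V≤r′+w : v K ≤ r′ + w
    V≤r′+w = split-≤ r′ 1 (u (suc K)) eq (subst (_≤ r + w) (v-suc≡1*u+v K) V′≤r+w)
  from-step (split r′ (suc (suc d)) _ eq)
    with split-leading-< r′ (suc (suc d)) (u (suc K)) 2 eq (<-≤-trans r< (v≤2u K))
  ... | s≤s (s≤s ())

-- The gap between f(a) and f(a + n)

raise : List ℕ → ℕ → List ℕ
raise x z = x ++ replicate z 0 ++ 1 ∷ []

raise-length : ∀ x z → length (raise x z) ≡ suc (length x + z)
raise-length x z = begin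
  length (raise x z)                                   ≡⟨ length-++ x ⟩
  length x + length (replicate z 0 ++ 1 ∷ [])          ≡⟨ cong (_+_ (length x)) (length-++ (replicate z 0)) ⟩
  length x + (length (replicate z 0) + 1)              ≡⟨ cong (λ t → length x + (t + 1)) (length-replicate z) ⟩
  length x + (z + 1)                                   ≡⟨ cong (_+_ (length x)) (+-comm z 1) ⟩
  length x + suc z                                     ≡⟨ +-suc (length x) z ⟩
  suc (length x + z)                                   ∎
  where open ≡-Reasoning

raise-value : ∀ x z → value (raise x z) ≡ value x + u (suc (length x + z))
raise-value x z = begin
  value (raise x z)                                    ≡⟨ valueFrom-++ 0 x _ ⟩
  value x + valueFrom (length x) (replicate z 0 ++ 1 ∷ []) ≡⟨ cong (_+_ (value x)) (valueFrom-zeros (length x) z _) ⟩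
  value x + (1 * u (suc (length x + z)) + 0)           ≡⟨ cong (_+_ (value x)) (trans (+-identityʳ _) (*-identityˡ _)) ⟩
  value x + u (suc (length x + z))                     ∎
  where open ≡-Reasoning

raise-shifted-1 : ∀ x z → shifted 1 (raise x z) ≡ shifted 1 x + u (length x + z)
raise-shifted-1 []      zero    = refl
raise-shifted-1 []      (suc z) = raise-value [] z
raise-shifted-1 (_ ∷ x) z       = raise-value x z

raise-fDigits : ∀ x z → fDigits (raise x z) ≡ fDigits x ℚ.+ weight (length x + z)
raise-fDigits x z = trans (fFrom-++ 0 x _)
  (cong (ℚ._+_ (fDigits x)) (trans (fFrom-zeros (length x) z _) (ℚ.+-identityʳ (weight (length x + z)))))

zeros-then-one : ∀ {s} z → ∃ (Run s (replicate z 0 ++ 1 ∷ []))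
zeros-then-one {s} zero = s , read1 []
zeros-then-one (suc z) with zeros-then-one {free} z
... | t , σ = t , read0 σ

raise-accepted : ∀ {x} z → Accepted x → Accepted (raise x z)
raise-accepted z (_ , σ) with zeros-then-one z
... | t , τ = t , Run-++ σ τ

module _ (x y : List ℕ) (n : ℕ) .{{_ : NonZero n}} (x-accepted : Accepted x) (y-accepted : Accepted y)
         (x+n≡y : value x + n ≡ value y) where

  private
    z M′ M : ℕ
    z = length y + n
    M′ = length x + z
    M = suc M′

    m : List ℕ
    m = greedy M′ n

    n<uM : n < u M
    n<uM = <-≤-trans (s≤s (≤-trans (m≤n+m n (length y)) (m≤n+m z (length x)))) (n≤u M)

    x-fits : Fits M x
    x-fits = x-accepted , ≤-trans (m≤m+n (length x) z) (n≤1+n M′)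

    y-fits : Fits M y
    y-fits = y-accepted , ≤-trans (m≤m+n (length y) n) (≤-trans (m≤n+m z (length x)) (n≤1+n M′))

    greedy-fits : ∀ N → N < u M → Fits M (greedy M′ N)
    greedy-fits N N< = greedy-accepted M′ N N< , ≤-trans (≤-reflexive (greedy-length M′ N)) (n≤1+n M′)

    greedy-shifted-1 : ∀ N → N < u M → shifted 1 (greedy M′ N) ≡ floorShift M N
    greedy-shifted-1 N N< = trans (floorShift-tail (greedy-fits N N<)) (cong (floorShift M) (greedy-value M′ N N<))

    x+m≡y : shifted 0 x + shifted 0 m ≡ shifted 0 y
    x+m≡y = trans (cong (_+_ (value x)) (greedy-value M′ n n<uM)) x+n≡y

    N′ : ℕ
    N′ = u M ∸ n

    m′ x⁺ : List ℕ
    m′ = greedy M′ N′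
    x⁺ = raise x z

    N′<uM : N′ < u M
    N′<uM = ∸-monoʳ-< {u M} {n} {0} (>-nonZero⁻¹ n) (<⇒≤ n<uM)

    n+N′≡uM : n + N′ ≡ u M
    n+N′≡uM = m+[n∸m]≡n (<⇒≤ n<uM)

    x⁺-fits : Fits M x⁺
    x⁺-fits = raise-accepted z x-accepted , ≤-reflexive (raise-length x z)

    y+m′≡x⁺ : shifted 0 y + shifted 0 m′ ≡ shifted 0 x⁺
    y+m′≡x⁺ = begin
      value y + value m′  ≡⟨ cong₂ _+_ (sym x+n≡y) (greedy-value M′ N′ N′<uM) ⟩
      value x + n + N′    ≡⟨ +-assoc (value x) n N′ ⟩
      value x + (n + N′)  ≡⟨ cong (_+_ (value x)) n+N′≡uM ⟩
      value x + u M       ≡⟨ sym (raise-value x z) ⟩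
      value x⁺            ∎
      where open ≡-Reasoning

    unit-carried : u M′ ≤ suc (shifted 1 m + shifted 1 m′)
    unit-carried = subst₂ _≤_ (trans (cong (floorShift M) n+N′≡uM) (floorShift-u M′))
      (cong suc (sym (cong₂ _+_ (greedy-shifted-1 n n<uM) (greedy-shifted-1 N′ N′<uM))))
      (floorShift-subadditive M n N′)

    carry-restored : shifted 1 x + shifted 1 m < shifted 1 y → shifted 1 y + shifted 1 m′ ≡ shifted 1 x⁺
    carry-restored carry = ≤-antisym
      (shifted-superadditive y-fits (greedy-fits N′ N′<uM) x⁺-fits (≤-reflexive y+m′≡x⁺) 1) (begin
      shifted 1 x⁺                                     ≡⟨ raise-shifted-1 x z ⟩
      shifted 1 x + u M′                               ≤⟨ +-monoʳ-≤ (shifted 1 x) unit-carried ⟩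
      shifted 1 x + suc (shifted 1 m + shifted 1 m′)   ≡⟨ +-suc (shifted 1 x) _ ⟩
      suc (shifted 1 x + (shifted 1 m + shifted 1 m′)) ≡⟨ cong suc (sym (+-assoc (shifted 1 x) _ _)) ⟩
      suc (shifted 1 x + shifted 1 m) + shifted 1 m′   ≤⟨ +-monoˡ-≤ (shifted 1 m′) carry ⟩
      shifted 1 y + shifted 1 m′                       ∎)
      where open ≤-Reasoning

    m′-bound : + 1 ℚ./ n ℚ.+ weight M′ ℚ.≤ fDigits m′
    m′-bound = recip+weight≤greedy M′ N′ n {{>-nonZero (m<n⇒0<n∸m n<uM)}} N′<uM
      (≤-reflexive (trans (sym n+N′≡uM) (+-comm n N′)))

  f-gap-without-carry : shifted 1 x + shifted 1 m ≡ shifted 1 y → + 1 ℚ./ n ℚ.≤ fDigits y ℚ.- fDigits x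
  f-gap-without-carry carry-free = p+q≤r⇒q≤r-p (fDigits x) _ (fDigits y)
    (ℚ.≤-trans (ℚ.+-monoʳ-≤ (fDigits x) (recip≤greedy M′ n n<uM))
               (fDigits-superadditive x-fits (greedy-fits n n<uM) y-fits x+m≡y carry-free))

  f-gap-with-carry : shifted 1 x + shifted 1 m < shifted 1 y → + 1 ℚ./ n ℚ.≤ fDigits x ℚ.- fDigits y
  f-gap-with-carry carry = subst (+ 1 ℚ./ n ℚ.≤_) (identity (fDigits x) (fDigits y) (weight M′))
    (p+q≤r⇒q≤r-p (fDigits y ℚ.+ weight M′) _ _ (begin
      fDigits y ℚ.+ weight M′ ℚ.+ + 1 ℚ./ n   ≡⟨ identity′ (fDigits y) (weight M′) (+ 1 ℚ./ n) ⟩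
      fDigits y ℚ.+ (+ 1 ℚ./ n ℚ.+ weight M′) ≤⟨ ℚ.+-monoʳ-≤ (fDigits y) m′-bound ⟩
      fDigits y ℚ.+ fDigits m′               ≤⟨ fDigits-superadditive y-fits (greedy-fits N′ N′<uM) x⁺-fits
                                                   y+m′≡x⁺ (carry-restored carry) ⟩
      fDigits x⁺                             ≡⟨ raise-fDigits x z ⟩
      fDigits x ℚ.+ weight M′                ∎))
    where
    open ℚ.≤-Reasoning
    identity : ∀ a b c → a ℚ.+ c ℚ.- (b ℚ.+ c) ≡ a ℚ.- b
    identity = Ring.solve-∀ ℚ-ring
    identity′ : ∀ a b c → a ℚ.+ b ℚ.+ c ≡ a ℚ.+ (c ℚ.+ b)
    identity′ = Ring.solve-∀ ℚ-ring

  recip≤∣f-difference∣ : + 1 ℚ./ n ℚ.≤ ℚ.∣ fDigits y ℚ.- fDigits x ∣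
  recip≤∣f-difference∣ with m≤n⇒m<n∨m≡n (shifted-superadditive x-fits (greedy-fits n n<uM) y-fits (≤-reflexive x+m≡y) 1)
  ... | inj₁ carry      = subst (+ 1 ℚ./ n ℚ.≤_) (∣p-q∣≡∣q-p∣ (fDigits x) (fDigits y)) (p≤∣q∣ (/-nonneg 1 n) (f-gap-with-carry carry))
  ... | inj₂ carry-free = p≤∣q∣ (/-nonneg 1 n) (f-gap-without-carry carry-free)

corollary22 : (a n : ℕ) → .{{_ : NonZero n}} → (ds es : List ℕ) →
    IsRep a ds → IsRep (a + n) es →
    (+ 1) ℚ./ n ℚ.≤ ℚ.∣ fDigits es ℚ.- fDigits ds ∣
corollary22 a n ds es (ds-admissible , ds-value) (es-admissible , es-value) =
  recip≤∣f-difference∣ ds es n (admissible⇒run-free ds-admissible) (admissible⇒run-free es-admissible)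
    (trans (cong (_+ n) ds-value) (sym es-value))
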